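{- For $m,n\ge1$, $|\{u\in\mathsf{Rec}^{\star}(D_{m,n}) : u\text{ is minimal}\}|=\binom{m+n-2}{m-1}$.
   Context: $D_{m,n}$ is the directed graph with vertices $v_0,\ldots,v_{m+n-1}$ and an arc $(v_i,v_j)$ whenever one of $i,j$ lies in $\{0,\ldots,m-1\}$ and the other in $\{m,\ldots,m+n-1\}$; $v_0$ is the sink. Configurations $x\in\mathbb{N}_0^{m+n-1}$; out-degree $d_i=n$ for $1\le i\le m-1$, $d_i=m$ for $m\le i\le m+n-1$; an unstable vertex ($x_i\ge d_i$) topples by losing $d_i$ grains and giving one grain to each non-sink out-neighbour; stable means all $x_i<d_i$; $\sigma(x)$ is the stable configuration reached by repeated toppling. A stable $u$ is recurrent if $u=\sigma(x)$ for some $x$ with $x_i\ge d_i$ for all $i$; $\mathsf{Rec}(D_{m,n})$ is the set of recurrent configurations and $\mathsf{Rec}^{\star}(D_{m,n})$ the set of recurrent $u$ with $u_1\le\cdots\le u_{m-1}$ and $u_m\le\cdots\le u_{m+n-1}$. $\mathsf{level}(u)=u_1+\cdots+u_{m+n-1}-n(m-1)$, and $u\in\mathsf{Rec}(D_{m,n})$ is minimal if $\mathsf{level}(u)$ is smallest possible over $\mathsf{Rec}(D_{m,n})$ (equivalently $\mathsf{level}(u)=0$). -}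

module Defs where

open import Data.Nat using (ℕ; zero; suc; _+_; _*_; _∸_; _≤_; _<_; _<ᵇ_)
open import Data.Nat.ListAction using (sum)
open import Data.Bool using (Bool; true; false; if_then_else_; _xor_)
open import Data.Fin using (Fin; toℕ; _≟_)
open import Data.Vec using (Vec; lookup; tabulate; toList)
open import Data.Integer using (ℤ; +_; _-_) renaming (_≤_ to _≤ℤ_)
open import Data.Product using (Σ; _×_)
open import Relation.Nullary.Decidable using (⌊_⌋)
open import Relation.Binary.PropositionalEquality using (_≡_)
open import Relation.Binary.Construct.Closure.ReflexiveTransitive using (Star)

-- The digraph D_{m,n}: vertices v_0,…,v_{m+n-1}, v_0 the sink.
-- Non-sink vertices v_1,…,v_{m+n-1} are indexed by k : Fin (m + n ∸ 1),
-- index k standing for the vertex v_{k+1}.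

NumV : ℕ → ℕ → ℕ
NumV m n = m + n ∸ 1

Config : ℕ → ℕ → Set
Config m n = Vec ℕ (NumV m n)

-- v_{k+1} lies in the first part {v_0,…,v_{m-1}} iff k+1 < m.
isFirst : (m n : ℕ) → Fin (NumV m n) → Bool
isFirst m n k = suc (toℕ k) <ᵇ m

deg : (m n : ℕ) → Fin (NumV m n) → ℕ
deg m n k = if isFirst m n k then n else m

adj : (m n : ℕ) → Fin (NumV m n) → Fin (NumV m n) → Bool
adj m n k j = isFirst m n k xor isFirst m n j

topple : (m n : ℕ) → Config m n → Fin (NumV m n) → Config m n
topple m n x k = tabulate λ j →
  if ⌊ j ≟ k ⌋ then lookup x j ∸ deg m n k
  else (if adj m n k j then suc (lookup x j) else lookup x j)

data Step (m n : ℕ) : Config m n → Config m n → Set where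
  step : (x : Config m n) (k : Fin (NumV m n)) →
         deg m n k ≤ lookup x k → Step m n x (topple m n x k)

Stable : (m n : ℕ) → Config m n → Set
Stable m n u = ∀ k → lookup u k < deg m n k

Stabilizes : (m n : ℕ) → Config m n → Config m n → Set
Stabilizes m n x u = Star (Step m n) x u × Stable m n u

Recurrent : (m n : ℕ) → Config m n → Set
Recurrent m n u =
  Stable m n u × Σ (Config m n) λ x → (∀ k → deg m n k ≤ lookup x k) × Stabilizes m n x u

Sorted : (m n : ℕ) → Config m n → Set
Sorted m n u = ∀ i j → toℕ i ≤ toℕ j → isFirst m n i ≡ isFirst m n j →
  lookup u i ≤ lookup u j

RecStar : (m n : ℕ) → Config m n → Set
RecStar m n u = Recurrent m n u × Sorted m n u

level : (m n : ℕ) → Config m n → ℤ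
level m n u = + sum (toList u) - + (n * (m ∸ 1))

Minimal : (m n : ℕ) → Config m n → Set
Minimal m n u = Recurrent m n u × (∀ v → Recurrent m n v → level m n u ≤ℤ level m n v)

module Submission where

-- Write m = p + 1: besides the sink, D_{m,n} has p first-part vertices of
-- out-degree n and n second-part vertices of out-degree p + 1.  For
-- a : Fin p → ℕ let u(a) = (a , b) with b_j = #{i : a_i ≤ j}.
--  * Lower bound (BurningTimes): a recurrent configuration carries at least
--    p·n grains (level ≥ 0), since along the toppling sequence each edge
--    between the parts leaves a grain at the endpoint that toppled first.
--    The same time stamps give the bound B_j ≥ #{i : A_i ≤ j} for sorted
--    recurrent configurations.
--  * Construction: for a with entries below n, u(a) carries exactly p·n
--    grains and is recurrent, via rounds of Dhar's burning algorithm.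
--  * Classification: the minimal sorted recurrent configurations are thus
--    exactly the u(a) with a nondecreasing and below n; these vectors are
--    listed by `sortedVecs` and counted by Pascal's rule.

open import Defs
import Data.Nat as ℕ
open import Data.Nat using (ℕ; zero; suc; _+_; _*_; _∸_; _≤_; _<_; z≤n; s≤s; _≤ᵇ_; _≡ᵇ_; pred)
open import Data.Nat.Properties hiding (_≟_)
open import Data.Nat.Combinatorics using (_C_; nCn≡1; nCk+nC[k+1]≡[n+1]C[k+1])
open import Data.Nat.ListAction as ListSum using ()
open import Data.Bool using (Bool; true; false; if_then_else_)
open import Data.Bool.Properties using (T-≡; ¬-not)
open import Data.Fin using (Fin; zero; suc; toℕ; _≟_; _↑ˡ_; _↑ʳ_; splitAt; fromℕ<)
open import Data.Fin.Properties
  using (toℕ-↑ˡ; toℕ-↑ʳ; ↑ˡ-injective; ↑ʳ-injective; toℕ<n; toℕ-injective; toℕ-fromℕ<;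
         splitAt⁻¹-↑ˡ; splitAt⁻¹-↑ʳ; splitAt-↑ˡ; splitAt-↑ʳ)
open import Data.Vec as V using (Vec; []; _∷_; lookup; tabulate; toList; _++_)
open import Data.Vec.Properties using (lookup∘tabulate; tabulate∘lookup; tabulate-cong; lookup-++ˡ; lookup-++ʳ; lookup-map)
open import Data.List as L using (List; []; _∷_; length)
open import Data.List.Properties using (length-map; length-++)
open import Data.List.Membership.Propositional using (_∈_; _∉_)
open import Data.List.Membership.Propositional.Properties using (∈-map⁺; ∈-map⁻; ∈-++⁺ˡ; ∈-++⁺ʳ; ∈-++⁻)
open import Data.List.Relation.Unary.Any using (here; there)
import Data.List.Relation.Unary.All as All
open import Data.List.Relation.Unary.AllPairs using ([]; _∷_)
open import Data.List.Relation.Unary.Unique.Propositional using (Unique)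
open import Data.List.Relation.Unary.Unique.Propositional.Properties using (map⁺; ++⁺)
import Data.Integer as ℤ
import Data.Integer.Properties as ℤP
import Data.Fin.Properties as Fin
open import Data.Product using (Σ; _×_; _,_)
open import Data.Sum using (inj₁; inj₂)
open import Data.Vec.Functional using (updateAt)
open import Data.Vec.Functional.Properties using (updateAt-updates; updateAt-minimal)
open import Function using (_∘_; Equivalence)
open import Function.Bundles using (_⇔_; mk⇔)
open import Relation.Nullary using (¬_; yes; no; contradiction)
open import Relation.Binary.Definitions using (tri<; tri≈; tri>)
open import Relation.Nullary.Decidable using (⌊_⌋)
open import Relation.Binary.PropositionalEquality
open import Relation.Binary.Construct.Closure.ReflexiveTransitive using (Star; ε; _◅_; _◅◅_)
open import Algebra.Properties.CommutativeMonoid.Sum +-0-commutativeMonoid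
  using (sum; sum-syntax; ∑-distrib-+; ∑-comm; sum-cong-≗)

≤ᵇ-true : ∀ {a b} → a ≤ b → (a ≤ᵇ b) ≡ true
≤ᵇ-true h = Equivalence.to T-≡ (≤⇒≤ᵇ h)

≤ᵇ-sound : ∀ {a b} → (a ≤ᵇ b) ≡ true → a ≤ b
≤ᵇ-sound {a} {b} e = ≤ᵇ⇒≤ a b (Equivalence.from T-≡ e)

≤ᵇ-false : ∀ {a b} → b < a → (a ≤ᵇ b) ≡ false
≤ᵇ-false h = ¬-not (λ e → <⇒≱ h (≤ᵇ-sound e))

≤ᵇ-suc : ∀ a b → (suc a ≤ᵇ suc b) ≡ (a ≤ᵇ b)
≤ᵇ-suc zero    b = refl
≤ᵇ-suc (suc a) b = refl

≡ᵇ-refl : ∀ a → (a ≡ᵇ a) ≡ true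
≡ᵇ-refl a = Equivalence.to T-≡ (≡⇒≡ᵇ a a refl)

≡ᵇ-sound : ∀ {a b} → (a ≡ᵇ b) ≡ true → a ≡ b
≡ᵇ-sound {a} {b} e = ≡ᵇ⇒≡ a b (Equivalence.from T-≡ e)

∸-suc : ∀ m K → K < m → m ∸ K ≡ suc (m ∸ suc K)
∸-suc (suc m) zero    _         = refl
∸-suc (suc m) (suc K) (s≤s K<m) = ∸-suc m K K<m

𝟙 : Bool → ℕ
𝟙 true  = 1
𝟙 false = 0

𝟙-≤ᵇ-complement : ∀ a k → 𝟙 (a ≤ᵇ k) + 𝟙 (suc k ≤ᵇ a) ≡ 1
𝟙-≤ᵇ-complement zero    zero    = refl
𝟙-≤ᵇ-complement zero    (suc k) = refl
𝟙-≤ᵇ-complement (suc a) zero    = refl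
𝟙-≤ᵇ-complement (suc a) (suc k) rewrite ≤ᵇ-suc a k | ≤ᵇ-suc (suc k) a = 𝟙-≤ᵇ-complement a k

𝟙-≤ᵇ-split : ∀ a K → 𝟙 (K ≤ᵇ a) ≡ 𝟙 (suc K ≤ᵇ a) + 𝟙 (a ≡ᵇ K)
𝟙-≤ᵇ-split zero    zero    = refl
𝟙-≤ᵇ-split zero    (suc K) = refl
𝟙-≤ᵇ-split (suc a) zero    = refl
𝟙-≤ᵇ-split (suc a) (suc K) rewrite ≤ᵇ-suc K a | ≤ᵇ-suc (suc K) a = 𝟙-≤ᵇ-split a K

𝟙-total : ∀ a b → 1 ≤ 𝟙 (a ≤ᵇ b) + 𝟙 (b ≤ᵇ a)
𝟙-total a b with ≤-total a b
... | inj₁ a≤b rewrite ≤ᵇ-true a≤b = s≤s z≤n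
... | inj₂ b≤a rewrite ≤ᵇ-true b≤a = m≤n+m 1 (𝟙 (a ≤ᵇ b))

∑-mono : ∀ {N} {f g : Fin N → ℕ} → (∀ i → f i ≤ g i) → sum f ≤ sum g
∑-mono {zero}  h = z≤n
∑-mono {suc N} h = +-mono-≤ (h zero) (∑-mono (h ∘ suc))

∑-const : ∀ N c → ∑[ i < N ] c ≡ N * c
∑-const zero    c = refl
∑-const (suc N) c = cong (c +_) (∑-const N c)

∑∑-one : ∀ p n → ∑[ i < p ] ∑[ j < n ] 1 ≡ p * n
∑∑-one p n = begin
  ∑[ i < p ] ∑[ j < n ] 1 ≡⟨ sum-cong-≗ {p} (λ _ → trans (∑-const n 1) (*-identityʳ n)) ⟩
  ∑[ i < p ] n            ≡⟨ ∑-const p n ⟩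
  p * n                   ∎
  where open ≡-Reasoning

∑-split : ∀ p n (f : Fin (p + n) → ℕ) →
          sum f ≡ ∑[ i < p ] f (i ↑ˡ n) + ∑[ j < n ] f (p ↑ʳ j)
∑-split zero    n f = refl
∑-split (suc p) n f =
  trans (cong (f zero +_) (∑-split p n (f ∘ suc))) (sym (+-assoc (f zero) _ _))

∑-rigid : ∀ {N} (f g : Fin N → ℕ) → (∀ i → g i ≤ f i) → sum f ≤ sum g → ∀ i → f i ≡ g i
∑-rigid f g g≤f Σf≤Σg zero = ≤-antisym f₀≤g₀ (g≤f zero)
  where
  f₀≤g₀ : f zero ≤ g zero
  f₀≤g₀ = +-cancelʳ-≤ _ _ _ (≤-trans Σf≤Σg (+-monoʳ-≤ (g zero) (∑-mono (g≤f ∘ suc))))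
∑-rigid f g g≤f Σf≤Σg (suc i) =
  ∑-rigid (f ∘ suc) (g ∘ suc) (g≤f ∘ suc)
    (+-cancelˡ-≤ (f zero) _ _ (≤-trans Σf≤Σg (+-monoˡ-≤ _ (g≤f zero)))) i

sum-toList : ∀ {N} (v : Vec ℕ N) → ListSum.sum (toList v) ≡ sum (lookup v)
sum-toList []      = refl
sum-toList (x ∷ v) = cong (x +_) (sum-toList v)

Vec-ext : ∀ {N} (x y : Vec ℕ N) → (∀ k → lookup x k ≡ lookup y k) → x ≡ y
Vec-ext x y same = trans (sym (tabulate∘lookup x)) (trans (tabulate-cong same) (tabulate∘lookup y))

𝟙≤1 : ∀ b → 𝟙 b ≤ 1
𝟙≤1 true  = ≤-refl
𝟙≤1 false = z≤n

count : ∀ {N} → (Fin N → Bool) → ℕ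
count {N} f = ∑[ i < N ] 𝟙 (f i)

count-≤ : ∀ {N} (f : Fin N → Bool) → count f ≤ N
count-≤ {N} f = subst (count f ≤_) (*-identityʳ N)
  (subst (count f ≤_) (∑-const N 1) (∑-mono (λ i → 𝟙≤1 (f i))))

count-mono : ∀ {N} (f g : Fin N → Bool) → (∀ i → f i ≡ true → g i ≡ true) → count f ≤ count g
count-mono f g f⇒g = ∑-mono (λ i → 𝟙-mono (f i) (g i) (f⇒g i))
  where
  𝟙-mono : ∀ a b → (a ≡ true → b ≡ true) → 𝟙 a ≤ 𝟙 b
  𝟙-mono false b _   = z≤n
  𝟙-mono true  b a⇒b rewrite a⇒b refl = ≤-refl

count-const : ∀ {N} (f : Fin N → Bool) b → (∀ i → f i ≡ b) → count f ≡ N * 𝟙 b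
count-const {N} f b f≡b = trans (sum-cong-≗ (cong 𝟙 ∘ f≡b)) (∑-const N (𝟙 b))

count-false : ∀ {N} (f : Fin N → Bool) → (∀ i → f i ≡ false) → count f ≡ 0
count-false {N} f f≡false = trans (count-const f false f≡false) (*-zeroʳ N)

count-true : ∀ {N} (f : Fin N → Bool) → (∀ i → f i ≡ true) → count f ≡ N
count-true {N} f f≡true = trans (count-const f true f≡true) (*-identityʳ N)

count-update : ∀ {N} (f g : Fin N → Bool) (i₀ : Fin N) →
               (∀ i → i ≢ i₀ → f i ≡ g i) → count f ≤ suc (count g)
count-update f g zero f≡g = begin
  𝟙 (f zero) + count (f ∘ suc) ≡⟨ cong (𝟙 (f zero) +_) (sum-cong-≗ (λ i → cong 𝟙 (f≡g (suc i) λ ()))) ⟩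
  𝟙 (f zero) + count (g ∘ suc) ≤⟨ +-monoˡ-≤ _ (𝟙≤1 (f zero)) ⟩
  suc (count (g ∘ suc))          ≤⟨ s≤s (m≤n+m _ (𝟙 (g zero))) ⟩
  suc (𝟙 (g zero) + count (g ∘ suc)) ∎
  where open ≤-Reasoning
count-update f g (suc i₀) f≡g = begin
  𝟙 (f zero) + count (f ∘ suc)        ≡⟨ cong (λ b → 𝟙 b + count (f ∘ suc)) (f≡g zero λ ()) ⟩
  𝟙 (g zero) + count (f ∘ suc)        ≤⟨ +-monoʳ-≤ (𝟙 (g zero)) (count-update (f ∘ suc) (g ∘ suc) i₀ agree) ⟩
  𝟙 (g zero) + suc (count (g ∘ suc))  ≡⟨ +-suc (𝟙 (g zero)) _ ⟩
  suc (𝟙 (g zero) + count (g ∘ suc))  ∎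
  where
  open ≤-Reasoning
  agree : ∀ i → i ≢ i₀ → f (suc i) ≡ g (suc i)
  agree i i≢i₀ = f≡g (suc i) (i≢i₀ ∘ Fin.suc-injective)

count-prefix : ∀ {N} c → c < N → count {N} (λ j → toℕ j ≤ᵇ c) ≡ suc c
count-prefix {suc N} zero    _ = cong suc (count-false {N} _ (λ _ → refl))
count-prefix {suc N} (suc c) (s≤s c<N) =
  cong suc (trans (sum-cong-≗ {N} (λ j → cong 𝟙 (≤ᵇ-suc (toℕ j) c))) (count-prefix c c<N))

count-suffix : ∀ N c → c ≤ N → count {N} (λ j → c ≤ᵇ toℕ j) ≡ N ∸ c
count-suffix zero    zero    _ = refl
count-suffix (suc N) zero    _ = count-true {suc N} _ (λ _ → refl)
count-suffix (suc N) (suc c) (s≤s c≤N) =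
  trans (sum-cong-≗ {N} (λ j → cong 𝟙 (≤ᵇ-suc c (toℕ j)))) (count-suffix N c c≤N)

argmin-upto : ∀ {N} (f : Fin N → ℕ) (k₀ : Fin N) →
  Σ (Fin N) λ m → toℕ m ≤ toℕ k₀ × (∀ j → toℕ j ≤ toℕ k₀ → f m ≤ f j)
argmin-upto f zero = zero , z≤n , λ { zero _ → ≤-refl }
argmin-upto f (suc k₀) with argmin-upto (f ∘ suc) k₀
... | m , m≤k₀ , min with f zero ≤? f (suc m)
...   | yes f₀≤ = zero , z≤n , λ { zero _ → ≤-refl ; (suc j) (s≤s j≤k₀) → ≤-trans f₀≤ (min j j≤k₀) }
...   | no f₀≰  = suc m , s≤s m≤k₀ , λ { zero _ → <⇒≤ (≰⇒> f₀≰) ; (suc j) (s≤s j≤k₀) → min j j≤k₀ }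

select : ∀ {N} → (Fin N → Bool) → List (Fin N)
select {zero}  f = []
select {suc N} f with f zero
... | true  = zero ∷ L.map suc (select (f ∘ suc))
... | false = L.map suc (select (f ∘ suc))

select-length : ∀ {N} (f : Fin N → Bool) → length (select f) ≡ count f
select-length {zero}  f = refl
select-length {suc N} f with f zero
... | true  = cong suc (trans (length-map suc (select (f ∘ suc))) (select-length (f ∘ suc)))
... | false = trans (length-map suc (select (f ∘ suc))) (select-length (f ∘ suc))

∈-select⁻ : ∀ {N} (f : Fin N → Bool) {i} → i ∈ select f → f i ≡ true
∈-select⁻ {suc N} f i∈ with f zero in f₀
∈-select⁻ {suc N} f (here refl) | true = f₀
∈-select⁻ {suc N} f (there i∈) | true with ∈-map⁻ suc i∈
... | _ , i∈′ , refl = ∈-select⁻ (f ∘ suc) i∈′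
∈-select⁻ {suc N} f i∈ | false with ∈-map⁻ suc i∈
... | _ , i∈′ , refl = ∈-select⁻ (f ∘ suc) i∈′

∈-select⁺ : ∀ {N} (f : Fin N → Bool) {i} → f i ≡ true → i ∈ select f
∈-select⁺ {suc N} f {i} fi with f zero in f₀
∈-select⁺ {suc N} f {zero}  fi | true  = here refl
∈-select⁺ {suc N} f {suc i} fi | true  = there (∈-map⁺ suc (∈-select⁺ (f ∘ suc) fi))
∈-select⁺ {suc N} f {zero}  fi | false = contradiction (trans (sym f₀) fi) λ ()
∈-select⁺ {suc N} f {suc i} fi | false = ∈-map⁺ suc (∈-select⁺ (f ∘ suc) fi)

select-unique : ∀ {N} (f : Fin N → Bool) → Unique (select f)
select-unique {zero}  f = []
select-unique {suc N} f with f zero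
... | true  = All.tabulate zero∉ ∷ map⁺ Fin.suc-injective (select-unique (f ∘ suc))
  where
  zero∉ : ∀ {i} → i ∈ L.map suc (select (f ∘ suc)) → zero ≢ i
  zero∉ i∈ with ∈-map⁻ suc i∈
  ... | _ , _ , refl = λ ()
... | false = map⁺ Fin.suc-injective (select-unique (f ∘ suc))

⌊≟⌋-refl : ∀ {N} (k : Fin N) → ⌊ k ≟ k ⌋ ≡ true
⌊≟⌋-refl k with k ≟ k
... | yes _   = refl
... | no k≢k = contradiction refl k≢k

⌊≟⌋-≢ : ∀ {N} {j k : Fin N} → j ≢ k → ⌊ j ≟ k ⌋ ≡ false
⌊≟⌋-≢ {j = j} {k} j≢k with j ≟ k
... | yes j≡k = contradiction j≡k j≢k
... | no _    = refl

topple-self : ∀ m n x k → lookup (topple m n x k) k ≡ lookup x k ∸ deg m n k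
topple-self m n x k rewrite lookup∘tabulate (λ j →
    if ⌊ j ≟ k ⌋ then lookup x j ∸ deg m n k
    else (if adj m n k j then suc (lookup x j) else lookup x j)) k
  | ⌊≟⌋-refl k = refl

topple-other : ∀ m n x k j → j ≢ k →
  lookup (topple m n x k) j ≡ (if adj m n k j then suc (lookup x j) else lookup x j)
topple-other m n x k j j≢k rewrite lookup∘tabulate (λ j →
    if ⌊ j ≟ k ⌋ then lookup x j ∸ deg m n k
    else (if adj m n k j then suc (lookup x j) else lookup x j)) j
  | ⌊≟⌋-≢ j≢k = refl

-- The graph D_{p+1,n}.  Its p + n non-sink vertices split into the first
-- part v_1,…,v_p (indices i ↑ˡ n, out-degree n) and the second part
-- v_{p+1},…,v_{p+n} (indices p ↑ʳ j, out-degree p + 1).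

module Bipartite (p n : ℕ) where

  Cfg : Set
  Cfg = Config (suc p) n

  A : Cfg → Fin p → ℕ
  A y i = lookup y (i ↑ˡ n)

  B : Cfg → Fin n → ℕ
  B y j = lookup y (p ↑ʳ j)

  data Side : Fin (p + n) → Set where
    first  : (i : Fin p) → Side (i ↑ˡ n)
    second : (j : Fin n) → Side (p ↑ʳ j)

  side : (k : Fin (p + n)) → Side k
  side k with splitAt p k in eq
  ... | inj₁ i = subst Side (splitAt⁻¹-↑ˡ eq) (first i)
  ... | inj₂ j = subst Side (splitAt⁻¹-↑ʳ eq) (second j)

  Cfg-ext : ∀ x y → (∀ i → A x i ≡ A y i) → (∀ j → B x j ≡ B y j) → x ≡ y
  Cfg-ext x y A≡ B≡ = Vec-ext x y same
    where
    same : ∀ k → lookup x k ≡ lookup y k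
    same k with side k
    ... | first i  = A≡ i
    ... | second j = B≡ j

  mkCfg : (Fin p → ℕ) → (Fin n → ℕ) → Cfg
  mkCfg f g = tabulate f ++ tabulate g

  A-mkCfg : ∀ f g i → A (mkCfg f g) i ≡ f i
  A-mkCfg f g i = trans (lookup-++ˡ (tabulate f) (tabulate g) i) (lookup∘tabulate f i)

  B-mkCfg : ∀ f g j → B (mkCfg f g) j ≡ g j
  B-mkCfg f g j = trans (lookup-++ʳ (tabulate f) (tabulate g) j) (lookup∘tabulate g j)

  config : (Fin p → ℕ) → Cfg
  config a = mkCfg a (λ j → count (λ i → a i ≤ᵇ toℕ j))

  config-cong : ∀ f g → (∀ i → f i ≡ g i) → config f ≡ config g
  config-cong f g f≡g = Cfg-ext _ _
    (λ i → trans (A-mkCfg _ _ i) (trans (f≡g i) (sym (A-mkCfg _ _ i))))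
    (λ j → trans (B-mkCfg _ _ j) (trans (sum-cong-≗ {p} (λ i → cong (λ v → 𝟙 (v ≤ᵇ toℕ j)) (f≡g i)))
                                        (sym (B-mkCfg _ _ j))))

  config-injective : ∀ {a a′ : Vec ℕ p} → config (lookup a) ≡ config (lookup a′) → a ≡ a′
  config-injective {a} {a′} eq =
    Vec-ext a a′ (λ i → trans (sym (A-mkCfg _ _ i)) (trans (cong (λ y → A y i) eq) (A-mkCfg _ _ i)))

  total-grains : ∀ y → ListSum.sum (toList y) ≡ sum (A y) + sum (B y)
  total-grains y = trans (sum-toList y) (∑-split p n (lookup y))

  isFirst-A : ∀ i → isFirst (suc p) n (i ↑ˡ n) ≡ true
  isFirst-A i rewrite toℕ-↑ˡ i n = ≤ᵇ-true (s≤s (toℕ<n i))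

  isFirst-B : ∀ j → isFirst (suc p) n (p ↑ʳ j) ≡ false
  isFirst-B j rewrite toℕ-↑ʳ p j = ≤ᵇ-false (s≤s (s≤s (m≤m+n p (toℕ j))))

  deg-A : ∀ i → deg (suc p) n (i ↑ˡ n) ≡ n
  deg-A i rewrite isFirst-A i = refl

  deg-B : ∀ j → deg (suc p) n (p ↑ʳ j) ≡ suc p
  deg-B j rewrite isFirst-B j = refl

  ↑ˡ≢↑ʳ : ∀ i j → i ↑ˡ n ≢ p ↑ʳ j
  ↑ˡ≢↑ʳ i j eq with trans (sym (splitAt-↑ˡ p i n)) (trans (cong (splitAt p) eq) (splitAt-↑ʳ p n j))
  ... | ()

  A-toppleA-self : ∀ y i₀ → A (topple (suc p) n y (i₀ ↑ˡ n)) i₀ ≡ A y i₀ ∸ n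
  A-toppleA-self y i₀ = trans (topple-self (suc p) n y (i₀ ↑ˡ n)) (cong (A y i₀ ∸_) (deg-A i₀))

  A-toppleA-other : ∀ y i₀ i → i ≢ i₀ → A (topple (suc p) n y (i₀ ↑ˡ n)) i ≡ A y i
  A-toppleA-other y i₀ i i≢i₀
    rewrite topple-other (suc p) n y (i₀ ↑ˡ n) (i ↑ˡ n) (i≢i₀ ∘ ↑ˡ-injective n i i₀)
          | isFirst-A i₀ | isFirst-A i = refl

  B-toppleA : ∀ y i₀ j → B (topple (suc p) n y (i₀ ↑ˡ n)) j ≡ suc (B y j)
  B-toppleA y i₀ j
    rewrite topple-other (suc p) n y (i₀ ↑ˡ n) (p ↑ʳ j) (↑ˡ≢↑ʳ i₀ j ∘ sym)
          | isFirst-A i₀ | isFirst-B j = refl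

  A-toppleB : ∀ y j₀ i → A (topple (suc p) n y (p ↑ʳ j₀)) i ≡ suc (A y i)
  A-toppleB y j₀ i
    rewrite topple-other (suc p) n y (p ↑ʳ j₀) (i ↑ˡ n) (↑ˡ≢↑ʳ i j₀)
          | isFirst-B j₀ | isFirst-A i = refl

  B-toppleB-self : ∀ y j₀ → B (topple (suc p) n y (p ↑ʳ j₀)) j₀ ≡ B y j₀ ∸ suc p
  B-toppleB-self y j₀ = trans (topple-self (suc p) n y (p ↑ʳ j₀)) (cong (B y j₀ ∸_) (deg-B j₀))

  B-toppleB-other : ∀ y j₀ j → j ≢ j₀ → B (topple (suc p) n y (p ↑ʳ j₀)) j ≡ B y j
  B-toppleB-other y j₀ j j≢j₀
    rewrite topple-other (suc p) n y (p ↑ʳ j₀) (p ↑ʳ j) (j≢j₀ ∘ ↑ʳ-injective p j j₀)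
          | isFirst-B j₀ | isFirst-B j = refl

  -- Each toppling is legal because the vertex still holds its n grains to lose.
  topple-firsts : (xs : List (Fin p)) → Unique xs → ∀ x y →
    (∀ i → i ∈ xs → A y i + n ≡ A x i) → (∀ i → i ∉ xs → A y i ≡ A x i) →
    (∀ j → B y j ≡ B x j + length xs) → Star (Step (suc p) n) x y
  topple-firsts [] _ x y _ A-rest B-gain =
    subst (Star (Step (suc p) n) x)
      (Cfg-ext x y (λ i → sym (A-rest i λ ())) (λ j → sym (trans (B-gain j) (+-identityʳ _)))) ε
  topple-firsts (i₀ ∷ xs) (i₀∉xs ∷ uniq) x y A-lose A-rest B-gain =
    step x (i₀ ↑ˡ n) legal ◅ topple-firsts xs uniq x′ y A-lose′ A-rest′ B-gain′
    where
    x′ = topple (suc p) n x (i₀ ↑ˡ n)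
    legal : deg (suc p) n (i₀ ↑ˡ n) ≤ lookup x (i₀ ↑ˡ n)
    legal = subst₂ _≤_ (sym (deg-A i₀)) (A-lose i₀ (here refl)) (m≤n+m n (A y i₀))
    ≢i₀ : ∀ {i} → i ∈ xs → i ≢ i₀
    ≢i₀ i∈ i≡i₀ = All.lookup i₀∉xs i∈ (sym i≡i₀)
    A-lose′ : ∀ i → i ∈ xs → A y i + n ≡ A x′ i
    A-lose′ i i∈ = trans (A-lose i (there i∈)) (sym (A-toppleA-other x i₀ i (≢i₀ i∈)))
    A-rest′ : ∀ i → i ∉ xs → A y i ≡ A x′ i
    A-rest′ i i∉ with i ≟ i₀
    ... | yes refl = sym (trans (A-toppleA-self x i₀)
                                (trans (cong (_∸ n) (sym (A-lose i₀ (here refl)))) (m+n∸n≡m (A y i₀) n)))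
    ... | no i≢i₀ = trans (A-rest i λ { (here i≡i₀) → i≢i₀ i≡i₀ ; (there i∈) → i∉ i∈ })
                          (sym (A-toppleA-other x i₀ i i≢i₀))
    B-gain′ : ∀ j → B y j ≡ B x′ j + length xs
    B-gain′ j = trans (B-gain j) (trans (+-suc (B x j) (length xs)) (cong (_+ length xs) (sym (B-toppleA x i₀ j))))

stamp : ∀ {N} → (Fin N → ℕ) → Fin N → ℕ → Fin N → ℕ
stamp τ i₀ t = updateAt τ i₀ (λ _ → suc t)

stamp-≤ : ∀ {N} (τ : Fin N → ℕ) i₀ t → (∀ i → τ i ≤ t) → ∀ i → stamp τ i₀ t i ≤ suc t
stamp-≤ τ i₀ t τ≤t i with i ≟ i₀
... | yes refl = ≤-reflexive (updateAt-updates i₀ τ)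
... | no i≢i₀  = ≤-trans (≤-reflexive (updateAt-minimal i i₀ τ i≢i₀)) (m≤n⇒m≤1+n (τ≤t i))

count-newest : ∀ {N} (τ : Fin N → ℕ) t → (∀ i → τ i ≤ t) → count (λ i → suc t ≤ᵇ τ i) ≡ 0
count-newest τ t τ≤t = count-false _ (λ i → ≤ᵇ-false (s≤s (τ≤t i)))

-- Along a toppling sequence record the time τ of the last toppling of each
-- vertex (0 = never toppled) and the current time t.  Invariant: a vertex
-- that never toppled still holds at least its out-degree, and a vertex that
-- last toppled at time τ holds at least one grain for each neighbour that
-- toppled at a time ≥ τ (each such toppling sent it a grain it has kept).

module BurningTimes (p n : ℕ) where
  open Bipartite p n

  record Stamps (y : Cfg) : Set where
    field
      τA    : Fin p → ℕ
      τB    : Fin n → ℕ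
      t     : ℕ
      τA≤t  : ∀ i → τA i ≤ t
      τB≤t  : ∀ j → τB j ≤ t
      freshA : ∀ i → τA i ≡ 0 → n ≤ A y i
      freshB : ∀ j → τB j ≡ 0 → suc p ≤ B y j
      keptA : ∀ i → 1 ≤ τA i → count (λ j → τA i ≤ᵇ τB j) ≤ A y i
      keptB : ∀ j → 1 ≤ τB j → count (λ i → τB j ≤ᵇ τA i) ≤ B y j

  stamps-start : ∀ x → (∀ k → deg (suc p) n k ≤ lookup x k) → Stamps x
  stamps-start x x≥deg = record
    { τA = λ _ → 0 ; τB = λ _ → 0 ; t = 0 ; τA≤t = λ _ → z≤n ; τB≤t = λ _ → z≤n
    ; freshA = λ i _ → subst (_≤ A x i) (deg-A i) (x≥deg (i ↑ˡ n))
    ; freshB = λ j _ → subst (_≤ B x j) (deg-B j) (x≥deg (p ↑ʳ j))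
    ; keptA = λ i () ; keptB = λ j () }

  stamps-toppleA : ∀ y i₀ → Stamps y → Stamps (topple (suc p) n y (i₀ ↑ˡ n))
  stamps-toppleA y i₀ S = record
    { τA = τA′ ; τB = τB ; t = suc t
    ; τA≤t = stamp-≤ τA i₀ t τA≤t ; τB≤t = λ j → m≤n⇒m≤1+n (τB≤t j)
    ; freshA = freshA′
    ; freshB = λ j τ≡0 → ≤-trans (freshB j τ≡0) (≤-trans (n≤1+n _) (≤-reflexive (sym (B-toppleA y i₀ j))))
    ; keptA = keptA′
    ; keptB = keptB′ }
    where
    open Stamps S
    y′  = topple (suc p) n y (i₀ ↑ˡ n)
    τA′ = stamp τA i₀ t
    freshA′ : ∀ i → τA′ i ≡ 0 → n ≤ A y′ i
    freshA′ i τ≡0 with i ≟ i₀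
    ... | yes refl = contradiction (trans (sym (updateAt-updates i₀ τA)) τ≡0) 1+n≢0
    ... | no i≢i₀ rewrite A-toppleA-other y i₀ i i≢i₀ =
      freshA i (trans (sym (updateAt-minimal i i₀ τA i≢i₀)) τ≡0)
    keptA′ : ∀ i → 1 ≤ τA′ i → count (λ j → τA′ i ≤ᵇ τB j) ≤ A y′ i
    keptA′ i toppled with i ≟ i₀
    ... | yes refl rewrite updateAt-updates i₀ {λ _ → suc t} τA | count-newest τB t τB≤t = z≤n
    ... | no i≢i₀ rewrite A-toppleA-other y i₀ i i≢i₀ | updateAt-minimal i i₀ {λ _ → suc t} τA i≢i₀ =
      keptA i toppled
    keptB′ : ∀ j → 1 ≤ τB j → count (λ i → τB j ≤ᵇ τA′ i) ≤ B y′ j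
    keptB′ j toppled rewrite B-toppleA y i₀ j =
      ≤-trans (count-update _ _ i₀ (λ i i≢i₀ → cong (τB j ≤ᵇ_) (updateAt-minimal i i₀ τA i≢i₀)))
              (s≤s (keptB j toppled))

  stamps-toppleB : ∀ y j₀ → Stamps y → Stamps (topple (suc p) n y (p ↑ʳ j₀))
  stamps-toppleB y j₀ S = record
    { τA = τA ; τB = τB′ ; t = suc t
    ; τA≤t = λ i → m≤n⇒m≤1+n (τA≤t i) ; τB≤t = stamp-≤ τB j₀ t τB≤t
    ; freshA = λ i τ≡0 → ≤-trans (freshA i τ≡0) (≤-trans (n≤1+n _) (≤-reflexive (sym (A-toppleB y j₀ i))))
    ; freshB = freshB′
    ; keptA = keptA′
    ; keptB = keptB′ }
    where
    open Stamps S
    y′  = topple (suc p) n y (p ↑ʳ j₀)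
    τB′ = stamp τB j₀ t
    freshB′ : ∀ j → τB′ j ≡ 0 → suc p ≤ B y′ j
    freshB′ j τ≡0 with j ≟ j₀
    ... | yes refl = contradiction (trans (sym (updateAt-updates j₀ τB)) τ≡0) 1+n≢0
    ... | no j≢j₀ rewrite B-toppleB-other y j₀ j j≢j₀ =
      freshB j (trans (sym (updateAt-minimal j j₀ τB j≢j₀)) τ≡0)
    keptB′ : ∀ j → 1 ≤ τB′ j → count (λ i → τB′ j ≤ᵇ τA i) ≤ B y′ j
    keptB′ j toppled with j ≟ j₀
    ... | yes refl rewrite updateAt-updates j₀ {λ _ → suc t} τB | count-newest τA t τA≤t = z≤n
    ... | no j≢j₀ rewrite B-toppleB-other y j₀ j j≢j₀ | updateAt-minimal j j₀ {λ _ → suc t} τB j≢j₀ =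
      keptB j toppled
    keptA′ : ∀ i → 1 ≤ τA i → count (λ j → τA i ≤ᵇ τB′ j) ≤ A y′ i
    keptA′ i toppled rewrite A-toppleB y j₀ i =
      ≤-trans (count-update _ _ j₀ (λ j j≢j₀ → cong (τA i ≤ᵇ_) (updateAt-minimal j j₀ τB j≢j₀)))
              (s≤s (keptA i toppled))

  stamps-path : ∀ {x y} → Star (Step (suc p) n) x y → Stamps x → Stamps y
  stamps-path ε S = S
  stamps-path (step x k _ ◅ path) S with side k
  ... | first i  = stamps-path path (stamps-toppleA x i S)
  ... | second j = stamps-path path (stamps-toppleB x j S)

  stamps-recurrent : ∀ u → Recurrent (suc p) n u → Stamps u
  stamps-recurrent u (_ , x , x≥deg , path , _) = stamps-path path (stamps-start x x≥deg)

  module AtStable (u : Cfg) (S : Stamps u) (stable : Stable (suc p) n u) where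
    open Stamps S

    toppledA : ∀ i → 1 ≤ τA i
    toppledA i with τA i in τ≡
    ... | suc _ = s≤s z≤n
    ... | zero  = contradiction (freshA i τ≡) (<⇒≱ (subst (A u i <_) (deg-A i) (stable (i ↑ˡ n))))

    toppledB : ∀ j → 1 ≤ τB j
    toppledB j with τB j in τ≡
    ... | suc _ = s≤s z≤n
    ... | zero  = contradiction (freshB j τ≡) (<⇒≱ (subst (B u j <_) (deg-B j) (stable (p ↑ʳ j))))

    -- Each of the p·n edges between the parts contributes a grain to the
    -- endpoint that toppled first.
    grains-≥ : p * n ≤ sum (A u) + sum (B u)
    grains-≥ = begin
      p * n                                        ≡⟨ sym (∑∑-one p n) ⟩
      ∑[ i < p ] ∑[ j < n ] 1                      ≤⟨ ∑-mono (λ i → ∑-mono (λ j → 𝟙-total (τA i) (τB j))) ⟩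
      ∑[ i < p ] ∑[ j < n ] (a≤b i j + b≤a i j)   ≡⟨ sum-cong-≗ {p} (λ i → ∑-distrib-+ (a≤b i) (b≤a i)) ⟩
      ∑[ i < p ] (∑[ j < n ] a≤b i j + ∑[ j < n ] b≤a i j)
                                                   ≡⟨ ∑-distrib-+ (λ i → ∑[ j < n ] a≤b i j) (λ i → ∑[ j < n ] b≤a i j) ⟩
      ∑[ i < p ] ∑[ j < n ] a≤b i j + ∑[ i < p ] ∑[ j < n ] b≤a i j
                                                   ≡⟨ cong (∑[ i < p ] ∑[ j < n ] a≤b i j +_) (∑-comm b≤a) ⟩
      ∑[ i < p ] ∑[ j < n ] a≤b i j + ∑[ j < n ] ∑[ i < p ] b≤a i j
                                                   ≤⟨ +-mono-≤ (∑-mono (λ i → keptA i (toppledA i)))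
                                                               (∑-mono (λ j → keptB j (toppledB j))) ⟩
      sum (A u) + sum (B u)                        ∎
      where
      open ≤-Reasoning
      a≤b b≤a : Fin p → Fin n → ℕ
      a≤b i j = 𝟙 (τA i ≤ᵇ τB j)
      b≤a i j = 𝟙 (τB j ≤ᵇ τA i)

    -- Take j ≤ k₀ toppling
    -- first; a first-part vertex with A_i ≤ k₀ cannot have toppled before it,
    -- since it would then have received k₀ + 1 grains it kept.
    B-≥-count : ∀ k₀ → Σ (Fin n) λ j → toℕ j ≤ toℕ k₀ × count (λ i → A u i ≤ᵇ toℕ k₀) ≤ B u j
    B-≥-count k₀ with argmin-upto τB k₀
    ... | m , m≤k₀ , min = m , m≤k₀ , ≤-trans (count-mono _ _ after) (keptB m (toppledB m))
      where
      after : ∀ i → (A u i ≤ᵇ toℕ k₀) ≡ true → (τB m ≤ᵇ τA i) ≡ true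
      after i Ai≤k₀ with τB m ≤? τA i
      ... | yes m≤i = ≤ᵇ-true m≤i
      ... | no m≰i = contradiction (≤ᵇ-sound Ai≤k₀) (<⇒≱ (begin-strict
        toℕ k₀                              <⟨ n<1+n (toℕ k₀) ⟩
        suc (toℕ k₀)                        ≡⟨ sym (count-prefix (toℕ k₀) (toℕ<n k₀)) ⟩
        count {n} (λ j → toℕ j ≤ᵇ toℕ k₀)   ≤⟨ count-mono _ _ (λ j j≤k₀ → ≤ᵇ-true (≤-trans (<⇒≤ (≰⇒> m≰i))
                                                                                    (min j (≤ᵇ-sound j≤k₀)))) ⟩
        count (λ j → τA i ≤ᵇ τB j)          ≤⟨ keptA i (toppledA i) ⟩
        A u i                               ∎))
        where open ≤-Reasoning

module Construction (p n : ℕ) (a : Fin p → ℕ) (a<n : ∀ i → a i < n) where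
  open Bipartite p n

  F G E : ℕ → ℕ
  F k = count (λ i → a i ≤ᵇ k)
  G K = count (λ i → K ≤ᵇ a i)
  E K = count (λ i → a i ≡ᵇ K)

  b : Fin n → ℕ
  b j = F (toℕ j)

  u : Cfg
  u = config a

  F+G : ∀ k → F k + G (suc k) ≡ p
  F+G k = begin
    F k + G (suc k)                                ≡⟨ sym (∑-distrib-+ (λ i → 𝟙 (a i ≤ᵇ k))
                                                                        (λ i → 𝟙 (suc k ≤ᵇ a i))) ⟩
    ∑[ i < p ] (𝟙 (a i ≤ᵇ k) + 𝟙 (suc k ≤ᵇ a i))  ≡⟨ sum-cong-≗ {p} (λ i → 𝟙-≤ᵇ-complement (a i) k) ⟩
    ∑[ i < p ] 1                                   ≡⟨ ∑-const p 1 ⟩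
    p * 1                                          ≡⟨ *-identityʳ p ⟩
    p                                              ∎
    where open ≡-Reasoning

  G-split : ∀ K → G K ≡ G (suc K) + E K
  G-split K = trans (sum-cong-≗ {p} (λ i → 𝟙-≤ᵇ-split (a i) K))
                    (∑-distrib-+ (λ i → 𝟙 (suc K ≤ᵇ a i)) (λ i → 𝟙 (a i ≡ᵇ K)))

  G-zero : G 0 ≡ p
  G-zero = count-true _ (λ _ → refl)

  G-top : G n ≡ 0
  G-top = count-false _ (λ i → ≤ᵇ-false (a<n i))

  F-mono : ∀ {k k′} → k ≤ k′ → F k ≤ F k′
  F-mono {k} {k′} k≤k′ = count-mono (λ i → a i ≤ᵇ k) (λ i → a i ≤ᵇ k′)
    (λ i aᵢ≤k → ≤ᵇ-true (≤-trans (≤ᵇ-sound {a i} aᵢ≤k) k≤k′))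

  u-stable : Stable (suc p) n u
  u-stable k with side k
  ... | first i  = subst₂ _<_ (sym (A-mkCfg a b i)) (sym (deg-A i)) (a<n i)
  ... | second j = subst₂ _<_ (sym (B-mkCfg a b j)) (sym (deg-B j)) (s≤s (count-≤ _))

  -- Σ b counts the pairs (i, j) with a_i ≤ j, i.e. Σ_i (n − a_i).
  grains : sum a + sum b ≡ p * n
  grains = begin
    sum a + sum b                            ≡⟨ cong (sum a +_) (sym (∑-comm {p} {n} (λ i j → 𝟙 (a i ≤ᵇ toℕ j)))) ⟩
    sum a + ∑[ i < p ] count {n} (λ j → a i ≤ᵇ toℕ j)
                                             ≡⟨ cong (sum a +_) (sum-cong-≗ {p} (λ i → count-suffix n (a i) (<⇒≤ (a<n i)))) ⟩
    sum a + ∑[ i < p ] (n ∸ a i)             ≡⟨ sym (∑-distrib-+ a (λ i → n ∸ a i)) ⟩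
    ∑[ i < p ] (a i + (n ∸ a i))             ≡⟨ sum-cong-≗ {p} (λ i → m+[n∸m]≡n (<⇒≤ (a<n i))) ⟩
    ∑[ i < p ] n                             ≡⟨ ∑-const p n ⟩
    p * n                                    ∎
    where open ≡-Reasoning

  R : ℕ → Cfg
  R e = mkCfg a (λ j → b j + e)

  -- One round of Dhar's burning algorithm topples every vertex once and
  -- leads from R (e + 1) to R e.  The second-part vertices topple in the
  -- order j = n − 1, …, 0, each v_{p+1+K} followed by the first-part
  -- vertices with a_i = K.  W K is the configuration once every second-part
  -- vertex j ≥ K and every first-part vertex with a_i ≥ K has toppled.
  module Round (e : ℕ) where
    wA : ℕ → Fin p → ℕ
    wA K i = if K ≤ᵇ a i then a i ∸ K else a i + (n ∸ K)

    wB : ℕ → ℕ → ℕ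
    wB K c = if K ≤ᵇ c then (F c + suc e + G K) ∸ suc p else F c + suc e + G K

    W : ℕ → Cfg
    W K = mkCfg (wA K) (λ j → wB K (toℕ j))

    -- v_{p+1+c}, c ≥ K, has p + 1 grains to lose when its turn comes
    ready : ∀ K c → K ≤ c → suc p ≤ F c + suc e + G (suc K)
    ready K c K≤c = begin
      suc p                     ≡⟨ cong suc (sym (F+G K)) ⟩
      suc (F K + G (suc K))     ≤⟨ s≤s (+-monoˡ-≤ (G (suc K)) (F-mono K≤c)) ⟩
      suc (F c + G (suc K))     ≤⟨ s≤s (+-monoˡ-≤ (G (suc K)) (m≤m+n (F c) e)) ⟩
      suc (F c + e + G (suc K)) ≡⟨ cong (_+ G (suc K)) (sym (+-suc (F c) e)) ⟩
      F c + suc e + G (suc K)   ∎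
      where open ≤-Reasoning

    -- a first-part vertex with a_i = K is exactly full after v_{p+1+K} topples …
    wA-hit : ∀ K i → K < n → a i ≡ K → wA K i + n ≡ suc (wA (suc K) i)
    wA-hit K i K<n aᵢ≡K rewrite aᵢ≡K | ≤ᵇ-true (≤-refl {K}) | ≤ᵇ-false (n<1+n K) | n∸n≡0 K =
      sym (m+[n∸m]≡n K<n)

    -- … and every other one just receives a grain
    wA-miss : ∀ K i → K < n → a i ≢ K → wA K i ≡ suc (wA (suc K) i)
    wA-miss K i K<n aᵢ≢K with <-cmp (a i) K
    ... | tri< aᵢ<K _ _ rewrite ≤ᵇ-false aᵢ<K | ≤ᵇ-false (m<n⇒m<1+n aᵢ<K) =
      trans (cong (a i +_) (∸-suc n K K<n)) (+-suc (a i) (n ∸ suc K))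
    ... | tri≈ _ aᵢ≡K _ = contradiction aᵢ≡K aᵢ≢K
    ... | tri> _ _ K<aᵢ rewrite ≤ᵇ-true (<⇒≤ K<aᵢ) | ≤ᵇ-true K<aᵢ = ∸-suc (a i) K K<aᵢ

    -- a toppled second-part vertex keeps the E K grains of the new toppling
    wB-toppled : ∀ K c → K ≤ c →
      (F c + suc e + G K) ∸ suc p ≡ (F c + suc e + G (suc K)) ∸ suc p + E K
    wB-toppled K c K≤c =
      trans (cong (_∸ suc p) (trans (cong (F c + suc e +_) (G-split K)) (sym (+-assoc (F c + suc e) (G (suc K)) (E K)))))
            (+-∸-comm (E K) (ready K c K≤c))

    wB-untoppled : ∀ K c → F c + suc e + G K ≡ F c + suc e + G (suc K) + E K
    wB-untoppled K c = trans (cong (F c + suc e +_) (G-split K)) (sym (+-assoc (F c + suc e) (G (suc K)) (E K)))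

    stage : ∀ K → K < n → Star (Step (suc p) n) (W (suc K)) (W K)
    stage K K<n =
      step (W (suc K)) (p ↑ʳ jK) legal ◅
      topple-firsts (select hit) (select-unique hit) x₁ (W K) A-lose A-rest B-gain
      where
      jK : Fin n
      jK = fromℕ< K<n
      hit : Fin p → Bool
      hit i = a i ≡ᵇ K
      x₁ = topple (suc p) n (W (suc K)) (p ↑ʳ jK)
      legal : deg (suc p) n (p ↑ʳ jK) ≤ lookup (W (suc K)) (p ↑ʳ jK)
      legal rewrite deg-B jK | B-mkCfg (wA (suc K)) (λ j → wB (suc K) (toℕ j)) jK
                  | toℕ-fromℕ< K<n | ≤ᵇ-false (n<1+n K) = ready K K ≤-refl
      A-x₁ : ∀ i → A x₁ i ≡ suc (wA (suc K) i)
      A-x₁ i = trans (A-toppleB (W (suc K)) jK i) (cong suc (A-mkCfg _ _ i))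
      A-lose : ∀ i → i ∈ select hit → A (W K) i + n ≡ A x₁ i
      A-lose i i∈ = trans (cong (_+ n) (A-mkCfg _ _ i))
                          (trans (wA-hit K i K<n (≡ᵇ-sound (∈-select⁻ hit i∈))) (sym (A-x₁ i)))
      A-rest : ∀ i → i ∉ select hit → A (W K) i ≡ A x₁ i
      A-rest i i∉ = trans (A-mkCfg _ _ i) (trans (wA-miss K i K<n aᵢ≢K) (sym (A-x₁ i)))
        where
        aᵢ≢K : a i ≢ K
        aᵢ≢K aᵢ≡K = i∉ (∈-select⁺ hit (subst (λ v → (v ≡ᵇ K) ≡ true) (sym aᵢ≡K) (≡ᵇ-refl K)))
      B-x₁ : ∀ j → wB K (toℕ j) ≡ B x₁ j + E K
      B-x₁ j with j ≟ jK
      ... | yes refl rewrite B-toppleB-self (W (suc K)) jK | B-mkCfg (wA (suc K)) (λ j → wB (suc K) (toℕ j)) jK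
                           | toℕ-fromℕ< K<n | ≤ᵇ-true (≤-refl {K}) | ≤ᵇ-false (n<1+n K) = wB-toppled K K ≤-refl
      ... | no j≢jK rewrite B-toppleB-other (W (suc K)) jK j j≢jK | B-mkCfg (wA (suc K)) (λ j → wB (suc K) (toℕ j)) j
            with <-cmp (toℕ j) K
      ...   | tri< j<K _ _ rewrite ≤ᵇ-false j<K | ≤ᵇ-false (m<n⇒m<1+n j<K) = wB-untoppled K (toℕ j)
      ...   | tri≈ _ j≡K _ = contradiction (toℕ-injective (trans j≡K (sym (toℕ-fromℕ< K<n)))) j≢jK
      ...   | tri> _ _ K<j rewrite ≤ᵇ-true (<⇒≤ K<j) | ≤ᵇ-true K<j = wB-toppled K (toℕ j) (<⇒≤ K<j)
      B-gain : ∀ j → B (W K) j ≡ B x₁ j + length (select hit)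
      B-gain j = trans (B-mkCfg _ _ j) (trans (B-x₁ j) (cong (B x₁ j +_) (sym (select-length hit))))

    stages : ∀ d K → K + d ≡ n → Star (Step (suc p) n) (W n) (W K)
    stages zero    K K+0≡n rewrite +-identityʳ K | K+0≡n = ε
    stages (suc d) K K+d≡n =
      stages d (suc K) (trans (sym (+-suc K d)) K+d≡n) ◅◅ stage K (subst (K <_) K+d≡n (m<m+n K (s≤s z≤n)))

    W-start : W n ≡ R (suc e)
    W-start = Cfg-ext _ _
      (λ i → trans (A-mkCfg _ _ i) (trans (wA-n i) (sym (A-mkCfg _ _ i))))
      (λ j → trans (B-mkCfg _ _ j) (trans (wB-n j) (sym (B-mkCfg _ _ j))))
      where
      wA-n : ∀ i → wA n i ≡ a i
      wA-n i rewrite ≤ᵇ-false (a<n i) | n∸n≡0 n = +-identityʳ (a i)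
      wB-n : ∀ j → wB n (toℕ j) ≡ b j + suc e
      wB-n j rewrite ≤ᵇ-false (toℕ<n j) | G-top = +-identityʳ _

    W-end : W 0 ≡ R e
    W-end = Cfg-ext _ _
      (λ i → trans (A-mkCfg _ _ i) (sym (A-mkCfg _ _ i)))
      (λ j → trans (B-mkCfg _ _ j) (trans (wB-0 j) (sym (B-mkCfg _ _ j))))
      where
      wB-0 : ∀ j → wB 0 (toℕ j) ≡ b j + e
      wB-0 j rewrite G-zero = begin
        (b j + suc e + p) ∸ suc p ≡⟨ cong (_∸ suc p) (+-assoc (b j) (suc e) p) ⟩
        (b j + (suc e + p)) ∸ suc p ≡⟨ cong (λ s → (b j + s) ∸ suc p) (sym (+-suc e p)) ⟩
        (b j + (e + suc p)) ∸ suc p ≡⟨ cong (_∸ suc p) (sym (+-assoc (b j) e (suc p))) ⟩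
        (b j + e + suc p) ∸ suc p ≡⟨ m+n∸n≡m (b j + e) (suc p) ⟩
        b j + e ∎
        where open ≡-Reasoning

    round : Star (Step (suc p) n) (R (suc e)) (R e)
    round = subst₂ (Star (Step (suc p) n)) W-start W-end (stages n 0 refl)

  rounds : ∀ e → Star (Step (suc p) n) (R e) (R 0)
  rounds zero    = ε
  rounds (suc e) = Round.round e ◅◅ rounds e

  R-zero : R 0 ≡ u
  R-zero = Cfg-ext _ _
    (λ i → trans (A-mkCfg _ _ i) (sym (A-mkCfg _ _ i)))
    (λ j → trans (B-mkCfg _ _ j) (trans (+-identityʳ (b j)) (sym (B-mkCfg _ _ j))))

  x₀ : Cfg
  x₀ = mkCfg (λ i → a i + n) (λ j → b j + suc p)

  x₀-≥deg : ∀ k → deg (suc p) n k ≤ lookup x₀ k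
  x₀-≥deg k with side k
  ... | first i  = subst₂ _≤_ (sym (deg-A i)) (sym (A-mkCfg _ _ i)) (m≤n+m n (a i))
  ... | second j = subst₂ _≤_ (sym (deg-B j)) (sym (B-mkCfg _ _ j)) (m≤n+m (suc p) (b j))

  warm-up : Star (Step (suc p) n) x₀ (R (suc p + p))
  warm-up = topple-firsts (select every) (select-unique every) x₀ (R (suc p + p)) A-lose A-rest B-gain
    where
    every : Fin p → Bool
    every _ = true
    A-lose : ∀ i → i ∈ select every → A (R (suc p + p)) i + n ≡ A x₀ i
    A-lose i _ = trans (cong (_+ n) (A-mkCfg _ _ i)) (sym (A-mkCfg _ _ i))
    A-rest : ∀ i → i ∉ select every → A (R (suc p + p)) i ≡ A x₀ i
    A-rest i i∉ = contradiction (∈-select⁺ every refl) i∉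
    B-gain : ∀ j → B (R (suc p + p)) j ≡ B x₀ j + length (select every)
    B-gain j = begin
      B (R (suc p + p)) j           ≡⟨ B-mkCfg _ _ j ⟩
      b j + (suc p + p)             ≡⟨ sym (+-assoc (b j) (suc p) p) ⟩
      b j + suc p + p               ≡⟨ cong₂ _+_ (sym (B-mkCfg _ _ j))
                                                 (sym (trans (select-length every) (count-true every λ _ → refl))) ⟩
      B x₀ j + length (select every) ∎
      where open ≡-Reasoning

  u-recurrent : Recurrent (suc p) n u
  u-recurrent = u-stable , x₀ , x₀-≥deg ,
    (warm-up ◅◅ subst (Star (Step (suc p) n) (R (suc p + p))) R-zero (rounds (suc p + p))) , u-stable

-- They are listed
-- by the recursion: either the first entry is 0, or every entry is positive
-- and subtracting 1 everywhere gives such a vector with entries below r − 1.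
-- There are C(p + r − 1, p) of them (Pascal's rule).

SortedBelow : ∀ {p} → ℕ → Vec ℕ p → Set
SortedBelow r a = (∀ i → lookup a i < r) × (∀ i i′ → toℕ i ≤ toℕ i′ → lookup a i ≤ lookup a i′)

sortedVecs : (p r : ℕ) → List (Vec ℕ p)
sortedVecs zero    r       = [] ∷ []
sortedVecs (suc p) zero    = []
sortedVecs (suc p) (suc r) = L.map (0 ∷_) (sortedVecs p (suc r)) L.++ L.map (V.map ℕ.suc) (sortedVecs (suc p) r)

sortedVecs-sound : ∀ p r a → a ∈ sortedVecs p r → SortedBelow r a
sortedVecs-sound zero r [] _ = (λ ()) , (λ ())
sortedVecs-sound (suc p) (suc r) a a∈ with ∈-++⁻ (L.map (0 ∷_) (sortedVecs p (suc r))) a∈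
... | inj₁ a∈₀ with ∈-map⁻ (0 ∷_) a∈₀
...   | a′ , a′∈ , refl with sortedVecs-sound p (suc r) a′ a′∈
...     | below , sorted = (λ { zero → s≤s z≤n ; (suc i) → below i })
                         , (λ { zero _ _ → z≤n ; (suc i) (suc i′) (s≤s i≤i′) → sorted i i′ i≤i′ })
sortedVecs-sound (suc p) (suc r) a a∈ | inj₂ a∈₊ with ∈-map⁻ (V.map ℕ.suc) a∈₊
...   | a′ , a′∈ , refl with sortedVecs-sound (suc p) r a′ a′∈
...     | below , sorted = (λ i → subst (_< suc r) (sym (lookup-map i ℕ.suc a′)) (s≤s (below i)))
                         , (λ i i′ i≤i′ → subst₂ _≤_ (sym (lookup-map i ℕ.suc a′)) (sym (lookup-map i′ ℕ.suc a′))
                                                    (s≤s (sorted i i′ i≤i′)))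

map-suc-pred : ∀ {p} (a : Vec ℕ p) → (∀ i → 1 ≤ lookup a i) → V.map ℕ.suc (V.map pred a) ≡ a
map-suc-pred []          _   = refl
map-suc-pred (suc x ∷ a) a>0 = cong (suc x ∷_) (map-suc-pred a (a>0 ∘ suc))
map-suc-pred (zero  ∷ a) a>0 with a>0 zero
... | ()

sortedVecs-complete : ∀ p r a → SortedBelow r a → a ∈ sortedVecs p r
sortedVecs-complete zero    r       []      _ = here refl
sortedVecs-complete (suc p) zero    (x ∷ a) (below , _) with below zero
... | ()
sortedVecs-complete (suc p) (suc r) (zero ∷ a) (below , sorted) =
  ∈-++⁺ˡ (∈-map⁺ (0 ∷_) (sortedVecs-complete p (suc r) a
    (below ∘ suc , λ i i′ i≤i′ → sorted (suc i) (suc i′) (s≤s i≤i′))))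
sortedVecs-complete (suc p) (suc r) a@(suc x ∷ _) (below , sorted) =
  ∈-++⁺ʳ (L.map (0 ∷_) (sortedVecs p (suc r)))
    (subst (_∈ L.map (V.map ℕ.suc) (sortedVecs (suc p) r)) (map-suc-pred a positive)
      (∈-map⁺ (V.map ℕ.suc) (sortedVecs-complete (suc p) r (V.map pred a) (below′ , sorted′))))
  where
  positive : ∀ i → 1 ≤ lookup a i
  positive i = ≤-trans (s≤s z≤n) (sorted zero i z≤n)
  below′ : ∀ i → lookup (V.map pred a) i < r
  below′ i rewrite lookup-map i pred a with lookup a i | positive i | below i
  ... | suc v | _ | s≤s v<r = v<r
  sorted′ : ∀ i i′ → toℕ i ≤ toℕ i′ → lookup (V.map pred a) i ≤ lookup (V.map pred a) i′
  sorted′ i i′ i≤i′ rewrite lookup-map i pred a | lookup-map i′ pred a = pred-mono-≤ (sorted i i′ i≤i′)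

sortedVecs-unique : ∀ p r → Unique (sortedVecs p r)
sortedVecs-unique zero    r       = All.[] ∷ []
sortedVecs-unique (suc p) zero    = []
sortedVecs-unique (suc p) (suc r) =
  ++⁺ (map⁺ ∷-injectiveʳ (sortedVecs-unique p (suc r))) (map⁺ (map-suc-injective _ _) (sortedVecs-unique (suc p) r)) disjoint
  where
  ∷-injectiveʳ : ∀ {a b : Vec ℕ p} → _≡_ {A = Vec ℕ (suc p)} (0 ∷ a) (0 ∷ b) → a ≡ b
  ∷-injectiveʳ refl = refl
  map-suc-injective : ∀ {p} (a b : Vec ℕ p) → V.map ℕ.suc a ≡ V.map ℕ.suc b → a ≡ b
  map-suc-injective []      []      _  = refl
  map-suc-injective (x ∷ a) (y ∷ b) eq =
    cong₂ _∷_ (suc-injective (cong V.head eq)) (map-suc-injective a b (cong V.tail eq))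
  disjoint : ∀ {v} → ¬ (v ∈ L.map (0 ∷_) (sortedVecs p (suc r)) × v ∈ L.map (V.map ℕ.suc) (sortedVecs (suc p) r))
  disjoint (v∈₀ , v∈₊) with ∈-map⁻ (0 ∷_) v∈₀ | ∈-map⁻ (V.map ℕ.suc) v∈₊
  ... | _ , _ , refl | _ ∷ _ , _ , ()

sortedVecs-length : ∀ p q → length (sortedVecs p (suc q)) ≡ (p + q) C p
sortedVecs-length zero    q    = refl
sortedVecs-length (suc p) zero = begin
  length (L.map (0 ∷_) (sortedVecs p 1) L.++ [])   ≡⟨ length-++ (L.map (0 ∷_) (sortedVecs p 1)) ⟩
  length (L.map (0 ∷_) (sortedVecs p 1)) + 0        ≡⟨ +-identityʳ _ ⟩
  length (L.map (0 ∷_) (sortedVecs p 1))            ≡⟨ length-map (0 ∷_) (sortedVecs p 1) ⟩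
  length (sortedVecs p 1)                           ≡⟨ sortedVecs-length p 0 ⟩
  (p + 0) C p                                       ≡⟨ cong (_C p) (+-identityʳ p) ⟩
  p C p                                             ≡⟨ trans (nCn≡1 p) (sym (nCn≡1 (suc p))) ⟩
  suc p C suc p                                     ≡⟨ cong (_C suc p) (sym (+-identityʳ (suc p))) ⟩
  (suc p + 0) C suc p                               ∎
  where open ≡-Reasoning
sortedVecs-length (suc p) (suc q) = begin
  length (L.map (0 ∷_) zeros L.++ L.map (V.map ℕ.suc) positives)
    ≡⟨ length-++ (L.map (0 ∷_) zeros) ⟩
  length (L.map (0 ∷_) zeros) + length (L.map (V.map ℕ.suc) positives)
    ≡⟨ cong₂ _+_ (length-map (0 ∷_) zeros) (length-map (V.map ℕ.suc) positives) ⟩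
  length zeros + length positives
    ≡⟨ cong₂ _+_ (sortedVecs-length p (suc q)) (sortedVecs-length (suc p) q) ⟩
  (p + suc q) C p + suc (p + q) C suc p
    ≡⟨ cong (λ s → s C p + suc (p + q) C suc p) (+-suc p q) ⟩
  suc (p + q) C p + suc (p + q) C suc p
    ≡⟨ nCk+nC[k+1]≡[n+1]C[k+1] (suc (p + q)) p ⟩
  suc (suc (p + q)) C suc p
    ≡⟨ cong (λ s → suc s C suc p) (sym (+-suc p q)) ⟩
  (suc p + suc q) C suc p ∎
  where
  open ≡-Reasoning
  zeros     = sortedVecs p (suc (suc q))
  positives = sortedVecs (suc p) (suc q)

level-mono : ∀ s s′ c → s ≤ s′ → (ℤ.+ s ℤ.- ℤ.+ c) ℤ.≤ (ℤ.+ s′ ℤ.- ℤ.+ c)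
level-mono s s′ c s≤s′ = ℤP.+-monoˡ-≤ (ℤ.- ℤ.+ c) (ℤ.+≤+ s≤s′)

level-reflect : ∀ s s′ c → (ℤ.+ s ℤ.- ℤ.+ c) ℤ.≤ (ℤ.+ s′ ℤ.- ℤ.+ c) → s ≤ s′
level-reflect s s′ c ≤ = ℤP.drop‿+≤+ (subst₂ ℤ._≤_ (cancel s) (cancel s′) (ℤP.+-monoˡ-≤ (ℤ.+ c) ≤))
  where
  cancel : ∀ x → (ℤ.+ x ℤ.- ℤ.+ c) ℤ.+ ℤ.+ c ≡ ℤ.+ x
  cancel x = trans (ℤP.+-assoc (ℤ.+ x) (ℤ.- ℤ.+ c) (ℤ.+ c))
                   (trans (cong (λ z → ℤ.+ x ℤ.+ z) (ℤP.+-inverseˡ (ℤ.+ c))) (ℤP.+-identityʳ (ℤ.+ x)))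

module Classification (p n : ℕ) (n≥1 : 1 ≤ n) where
  open Bipartite p n
  open BurningTimes p n

  recurrent-grains : ∀ v → Recurrent (suc p) n v → p * n ≤ ListSum.sum (toList v)
  recurrent-grains v rec@(stable , _) = subst (p * n ≤_) (sym (total-grains v))
    (AtStable.grains-≥ v (stamps-recurrent v rec) stable)

  config-grains : ∀ a → (∀ i → a i < n) → ListSum.sum (toList (config a)) ≡ p * n
  config-grains a a<n = trans (total-grains (config a))
    (trans (cong₂ _+_ (sum-cong-≗ {p} (A-mkCfg _ _)) (sum-cong-≗ {n} (B-mkCfg _ _))) (Construction.grains p n a a<n))

  -- the level-0 configuration u(0) shows that minimal means level ≤ 0
  minimal-grains : ∀ u → Minimal (suc p) n u → ListSum.sum (toList u) ≤ p * n
  minimal-grains u (_ , least) = subst (ListSum.sum (toList u) ≤_) (config-grains zeros zeros<n)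
    (level-reflect _ _ (n * p) (least (config zeros) (Construction.u-recurrent p n zeros zeros<n)))
    where
    zeros : Fin p → ℕ
    zeros _ = 0
    zeros<n : ∀ i → zeros i < n
    zeros<n _ = n≥1

  config-minimal : ∀ a → (∀ i → a i < n) → Minimal (suc p) n (config a)
  config-minimal a a<n = Construction.u-recurrent p n a a<n , λ v rec →
    level-mono _ _ (n * p) (subst (_≤ ListSum.sum (toList v)) (sym (config-grains a a<n)) (recurrent-grains v rec))

  A-sorted : ∀ u → Sorted (suc p) n u → ∀ i i′ → toℕ i ≤ toℕ i′ → A u i ≤ A u i′
  A-sorted u sorted i i′ i≤i′ = sorted (i ↑ˡ n) (i′ ↑ˡ n)
    (subst₂ _≤_ (sym (toℕ-↑ˡ i n)) (sym (toℕ-↑ˡ i′ n)) i≤i′) (trans (isFirst-A i) (sym (isFirst-A i′)))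

  B-sorted : ∀ u → Sorted (suc p) n u → ∀ j j′ → toℕ j ≤ toℕ j′ → B u j ≤ B u j′
  B-sorted u sorted j j′ j≤j′ = sorted (p ↑ʳ j) (p ↑ʳ j′)
    (subst₂ _≤_ (sym (toℕ-↑ʳ p j)) (sym (toℕ-↑ʳ p j′)) (+-monoʳ-≤ p j≤j′))
    (trans (isFirst-B j) (sym (isFirst-B j′)))

  config-sorted : ∀ a → SortedBelow n a → Sorted (suc p) n (config (lookup a))
  config-sorted a (below , sorted) k k′ k≤k′ same-side with side k | side k′
  ... | first i | first i′ = subst₂ _≤_ (sym (A-mkCfg _ _ i)) (sym (A-mkCfg _ _ i′))
          (sorted i i′ (subst₂ _≤_ (toℕ-↑ˡ i n) (toℕ-↑ˡ i′ n) k≤k′))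
  ... | second j | second j′ = subst₂ _≤_ (sym (B-mkCfg _ _ j)) (sym (B-mkCfg _ _ j′))
          (Construction.F-mono p n (lookup a) below
            (+-cancelˡ-≤ p _ _ (subst₂ _≤_ (toℕ-↑ʳ p j) (toℕ-↑ʳ p j′) k≤k′)))
  ... | first i | second j = contradiction (trans (sym (isFirst-A i)) (trans same-side (isFirst-B j))) λ ()
  ... | second j | first i = contradiction (trans (sym (isFirst-A i)) (trans (sym same-side) (isFirst-B j))) λ ()

  minimal-is-config : ∀ u → RecStar (suc p) n u → Minimal (suc p) n u → u ≡ config (A u)
  minimal-is-config u (rec@(stable , _) , sorted) minimal =
    Cfg-ext u (config (A u)) (λ i → sym (A-mkCfg _ _ i)) (λ j → trans (B≡b j) (sym (B-mkCfg _ _ j)))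
    where
    b : Fin n → ℕ
    b j = count (λ i → A u i ≤ᵇ toℕ j)
    A<n : ∀ i → A u i < n
    A<n i = subst (A u i <_) (deg-A i) (stable (i ↑ˡ n))
    b≤B : ∀ j → b j ≤ B u j
    b≤B j with AtStable.B-≥-count u (stamps-recurrent u rec) stable j
    ... | j′ , j′≤j , b≤Bj′ = ≤-trans b≤Bj′ (B-sorted u sorted j′ j j′≤j)
    ΣB≤Σb : sum (B u) ≤ sum b
    ΣB≤Σb = +-cancelˡ-≤ (sum (A u)) _ _ (begin
      sum (A u) + sum (B u)          ≡⟨ sym (total-grains u) ⟩
      ListSum.sum (toList u)         ≤⟨ minimal-grains u minimal ⟩
      p * n                          ≡⟨ sym (Construction.grains p n (A u) A<n) ⟩
      sum (A u) + sum b              ∎)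
      where open ≤-Reasoning
    B≡b : ∀ j → B u j ≡ b j
    B≡b = ∑-rigid (B u) b b≤B ΣB≤Σb

  classification : ∀ u → (RecStar (suc p) n u × Minimal (suc p) n u) ⇔
                         (Σ (Vec ℕ p) λ a → SortedBelow n a × u ≡ config (lookup a))
  classification u = mk⇔ to from
    where
    to : RecStar (suc p) n u × Minimal (suc p) n u → Σ (Vec ℕ p) λ a → SortedBelow n a × u ≡ config (lookup a)
    to (recstar@((stable , _) , sorted) , minimal) = tabulate (A u) , (below , sorted′) ,
      trans (minimal-is-config u recstar minimal) (config-cong _ _ (λ i → sym (lookup∘tabulate (A u) i)))
      where
      below : ∀ i → lookup (tabulate (A u)) i < n
      below i rewrite lookup∘tabulate (A u) i = subst (A u i <_) (deg-A i) (stable (i ↑ˡ n))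
      sorted′ : ∀ i i′ → toℕ i ≤ toℕ i′ → lookup (tabulate (A u)) i ≤ lookup (tabulate (A u)) i′
      sorted′ i i′ rewrite lookup∘tabulate (A u) i | lookup∘tabulate (A u) i′ = A-sorted u sorted i i′
    from : (Σ (Vec ℕ p) λ a → SortedBelow n a × u ≡ config (lookup a)) → RecStar (suc p) n u × Minimal (suc p) n u
    from (a , sortedBelow@(below , _) , refl) =
      (Construction.u-recurrent p n (lookup a) below , config-sorted a sortedBelow) , config-minimal (lookup a) below

mainTheorem6 : (m n : ℕ) → 1 ≤ m → 1 ≤ n →
    Σ (List (Config m n)) λ L →
      Unique L × (∀ u → (u ∈ L) ⇔ (RecStar m n u × Minimal m n u)) ×
      length L ≡ (m + n ∸ 2) C (m ∸ 1)
mainTheorem6 (suc p) (suc q) _ n≥1 = L.map (config ∘ lookup) vecs , unique , membership , size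
  where
  open Bipartite p (suc q)
  open Classification p (suc q) n≥1
  vecs : List (Vec ℕ p)
  vecs = sortedVecs p (suc q)
  unique : Unique (L.map (config ∘ lookup) vecs)
  unique = map⁺ config-injective (sortedVecs-unique p (suc q))
  membership : ∀ u → (u ∈ L.map (config ∘ lookup) vecs) ⇔ (RecStar (suc p) (suc q) u × Minimal (suc p) (suc q) u)
  membership u = mk⇔
    (λ u∈ → let a , a∈ , u≡ = ∈-map⁻ (config ∘ lookup) u∈
            in Equivalence.from (classification u) (a , sortedVecs-sound p (suc q) a a∈ , u≡))
    (λ minimal → let a , sortedBelow , u≡ = Equivalence.to (classification u) minimal
                 in subst (_∈ _) (sym u≡) (∈-map⁺ (config ∘ lookup) (sortedVecs-complete p (suc q) a sortedBelow)))
  size : length (L.map (config ∘ lookup) vecs) ≡ (suc p + suc q ∸ 2) C p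
  size = trans (length-map (config ∘ lookup) vecs)
               (trans (sortedVecs-length p q) (cong (λ s → (s ∸ 1) C p) (sym (+-suc p q))))
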